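{- Let $G$ be a finite simple graph with minimum degree $\delta(G) \ge 1$ and maximum degree $\Delta(G)$, and let $k = \lceil 2\Delta(G)/\delta(G) \rceil$. Then: (1) $G$ admits a dynamic vertex coloring with $k+1$ colors; (2) if moreover $\delta(G) \ge 3$ and $k \ge 3$, then $G$ admits a dynamic vertex coloring with $k$ colors.
   Context: A vertex coloring of a graph $G$ (not required to be proper) is called dynamic if every vertex $v$ of degree at least $2$ has, among the vertices of its neighborhood $N_G(v)$ (the set of vertices adjacent to $v$), at least two vertices of different colors. $\delta(G)$ and $\Delta(G)$ denote the minimum and maximum vertex degrees of $G$. -}

module Defs where

open import Data.Nat using (ℕ; suc; _+_; _*_; _∸_; _/_; _≤_)
open import Data.Bool using (Bool; true; false)
open import Data.Fin using (Fin)
open import Data.List using (List; length; filterᵇ; allFin)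
open import Data.Product using (Σ; ∃; ∃-syntax; _×_)
open import Relation.Binary.PropositionalEquality using (_≡_; _≢_)

record SimpleGraph (n : ℕ) : Set where
  field
    adj    : Fin n → Fin n → Bool
    sym    : ∀ u v → adj u v ≡ adj v u
    irrefl : ∀ v → adj v v ≡ false

open SimpleGraph public

degree : ∀ {n} → SimpleGraph n → Fin n → ℕ
degree {n} G v = length (filterᵇ (adj G v) (allFin n))

IsMinDegree : ∀ {n} → SimpleGraph n → ℕ → Set
IsMinDegree G δ = (∀ v → δ ≤ degree G v) × (∃[ v ] degree G v ≡ δ)

IsMaxDegree : ∀ {n} → SimpleGraph n → ℕ → Set
IsMaxDegree G Δ = (∀ v → degree G v ≤ Δ) × (∃[ v ] degree G v ≡ Δ)

ceilDiv : ℕ → (d : ℕ) → .{{_ : Data.Nat.NonZero d}} → ℕ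
ceilDiv a d = (a + (d ∸ 1)) / d

-- a (not necessarily proper) colouring with c colours is dynamic if every
-- vertex of degree ≥ 2 has two neighbours of different colours
IsDynamic : ∀ {n c} → SimpleGraph n → (Fin n → Fin c) → Set
IsDynamic {n} G col =
  ∀ v → 2 ≤ degree G v →
    ∃[ u ] ∃[ w ] (adj G v u ≡ true × adj G v w ≡ true × col u ≢ col w)

HasDynamicColouring : ∀ {n} → SimpleGraph n → ℕ → Set
HasDynamicColouring {n} G c = Σ (Fin n → Fin c) (λ col → IsDynamic G col)

module Submission where

-- Every vertex x of degree ≥ 2 fixes its least neighbour m x (its anchor) and chooses another
-- neighbour t x after the anchor; a colouring in which t x and m x always differ is dynamic.
-- If the choice is such that every vertex is chosen at most L times, colouring the vertices
-- greedily in index order needs only L + 1 colours: when v is coloured it must avoid the colours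
-- of the anchors m x (already coloured, as m x < t x) of the at most L constraints with t x = v.
--
-- Such a choice exists by a Hall-type load-balancing argument: x has deg x − 1 admissible
-- choices, a vertex y is admissible for at most deg y ≤ Δ vertices, and Δ ≤ L (deg x − 1).
-- Overloaded vertices are relieved along alternating paths; if no path reaches an underloaded
-- vertex, the reachable set is closed and double counting its admissible pairs is contradictory.

open import Defs hiding (sym)

open import Data.Bool using (Bool; true; false; _∧_; not; if_then_else_)
import Data.Bool as Bool
open import Data.Empty using (⊥; ⊥-elim)
open import Data.Fin using (Fin; zero; suc; toℕ; fromℕ<)
open import Data.Fin.Properties using (_≟_; any?; toℕ-injective; toℕ-fromℕ<; toℕ<n)
open import Data.List using (length; filterᵇ; tabulate)
open import Data.Maybe using (Maybe; just; nothing; fromMaybe)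
import Data.Maybe as Maybe
open import Data.Nat using (ℕ; zero; suc; _+_; _*_; _∸_; _≤_; _<_; z≤n; s≤s; _<?_; _≤?_; NonZero; _%_)
open import Data.Nat.DivMod using (m≡m%n+[m/n]*n; m%n<n)
open import Data.Nat.Properties hiding (_≟_)
open import Data.Nat.Tactic.RingSolver using (solve-∀)
open import Data.Product using (∃; ∃₂; _×_; _,_; proj₁; proj₂)
open import Data.Sum using (_⊎_; inj₁; inj₂)
open import Function using (_∘_)
open import Relation.Binary.PropositionalEquality
open import Relation.Nullary using (Dec; yes; no; does; ¬_; ¬?)
open import Relation.Nullary.Decidable using (dec-true; dec-false; _×-dec_; _⊎-dec_)
open import Relation.Nullary.Negation using (contradiction)

open import Algebra.Properties.Semiring.Sum +-*-semiring
  using (sum; sum-syntax; ∑-distrib-+; ∑-comm; *-distribˡ-sum; *-distribʳ-sum; sum-cong-≗; sum-replicate-zero)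

ι : Bool → ℕ
ι true  = 1
ι false = 0

ι-true : ∀ {b} → 0 < ι b → b ≡ true
ι-true {true} _ = refl

does-true : ∀ {P : Set} (d : Dec P) → does d ≡ true → P
does-true (yes p) _ = p

∧-true : ∀ {a b} → (a ∧ b) ≡ true → a ≡ true × b ≡ true
∧-true {true} {true} _ = refl , refl

ι-mono : ∀ a c → (a ≡ true → c ≡ true) → ι a ≤ ι c
ι-mono true  c h rewrite h refl = ≤-refl
ι-mono false c h = z≤n

ι-guard : ∀ r {a c} → (r ≡ true → a ≤ c) → ι r * a ≤ ι r * c
ι-guard true  h = *-monoʳ-≤ 1 (h refl)
ι-guard false h = z≤n

ι-*-mono : ∀ a c d e → (a ≡ true → c ≡ true → d ≡ true × e ≡ true) → ι a * ι c ≤ ι d * ι e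
ι-*-mono true  true  d e h with h refl refl
... | refl , refl = ≤-refl
ι-*-mono true  false d e h = z≤n
ι-*-mono false c     d e h = z≤n

_==_ : ∀ {n} → Fin n → Fin n → Bool
i == j = does (i ≟ j)

==-refl : ∀ {n} (i : Fin n) → (i == i) ≡ true
==-refl i = dec-true (i ≟ i) refl

==-false : ∀ {n} {i j : Fin n} → i ≢ j → (i == j) ≡ false
==-false {i = i} {j} = dec-false (i ≟ j)

==-sound : ∀ {n} {i j : Fin n} → (i == j) ≡ true → i ≡ j
==-sound {i = i} {j} = does-true (i ≟ j)

count : ∀ {n} → (Fin n → Bool) → ℕ
count {n} p = ∑[ i < n ] ι (p i)

sum-mono : ∀ {n} {f g : Fin n → ℕ} → (∀ i → f i ≤ g i) → sum f ≤ sum g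
sum-mono {zero}  _ = z≤n
sum-mono {suc n} h = +-mono-≤ (h zero) (sum-mono (h ∘ suc))

term≤sum : ∀ {n} (f : Fin n → ℕ) i → f i ≤ sum f
term≤sum f zero    = m≤m+n _ _
term≤sum f (suc i) = ≤-trans (term≤sum (f ∘ suc) i) (m≤n+m _ _)

sum-pos : ∀ {n} (f : Fin n → ℕ) → 0 < sum f → ∃ λ i → 0 < f i
sum-pos {suc n} f h with f zero in eq
... | suc _ = zero , subst (0 <_) (sym eq) (s≤s z≤n)
... | zero with sum-pos (f ∘ suc) h
...   | i , p = suc i , p

count-witness : ∀ {n} (p : Fin n → Bool) → 0 < count p → ∃ λ i → p i ≡ true
count-witness p h with sum-pos (ι ∘ p) h
... | i , pos = i , ι-true pos

count≤ : ∀ {n} (p : Fin n → Bool) → count p ≤ n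
count≤ {zero}  p = z≤n
count≤ {suc n} p = +-mono-≤ (ι≤1 (p zero)) (count≤ (p ∘ suc))
  where
  ι≤1 : ∀ b → ι b ≤ 1
  ι≤1 true  = ≤-refl
  ι≤1 false = z≤n

count-all : ∀ n → count {n} (λ _ → true) ≡ n
count-all zero    = refl
count-all (suc n) = cong suc (count-all n)

sum-pick : ∀ {n} (j : Fin n) (g : Fin n → ℕ) → ∑[ i < n ] (ι (i == j) * g i) ≡ g j
sum-pick {suc n} zero g =
  trans (cong₂ _+_ (+-identityʳ (g zero)) (sum-replicate-zero n)) (+-identityʳ (g zero))
sum-pick {suc n} (suc j) g = sum-pick j (g ∘ suc)

count-single : ∀ {n} (j : Fin n) → count (_== j) ≡ 1
count-single j = trans (sum-cong-≗ (λ i → sym (*-identityʳ (ι (i == j))))) (sum-pick j (λ _ → 1))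

sum-update : ∀ {n} (j : Fin n) (f g : Fin n → ℕ) → (∀ i → i ≢ j → f i ≡ g i) →
             sum f + g j ≡ sum g + f j
sum-update {n} j f g agree = begin
  sum f + g j                              ≡⟨ cong (sum f +_) (sum-pick j g) ⟨
  sum f + ∑[ i < n ] (ι (i == j) * g i)     ≡⟨ ∑-distrib-+ f _ ⟨
  ∑[ i < n ] (f i + ι (i == j) * g i)       ≡⟨ sum-cong-≗ exchange ⟩
  ∑[ i < n ] (g i + ι (i == j) * f i)       ≡⟨ ∑-distrib-+ g _ ⟩
  sum g + ∑[ i < n ] (ι (i == j) * f i)     ≡⟨ cong (sum g +_) (sum-pick j f) ⟩
  sum g + f j                              ∎
  where
  open ≡-Reasoning
  exchange : ∀ i → f i + ι (i == j) * g i ≡ g i + ι (i == j) * f i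
  exchange i with i ≟ j
  ... | yes refl rewrite +-identityʳ (g i) | +-identityʳ (f i) = +-comm (f i) (g i)
  ... | no i≢j = cong (_+ 0) (agree i i≢j)

load : ∀ {m n} → (Fin m → Bool) → (Fin m → Fin n) → Fin n → ℕ
load C t v = count (λ x → C x ∧ (v == t x))

-- Clients x (with C x) each have to choose an admissible
-- server y (with A x y).  Starting from an admissible choice, overloaded servers are relieved
-- by pushing clients along alternating paths towards underloaded servers.
module LoadBalancing {m n : ℕ} (C : Fin m → Bool) (A : Fin m → Fin n → Bool) where

  -- a choice assigns a server to every client (only the clients with C x matter)
  Choice : Set
  Choice = Fin m → Fin n

  Admissible : Choice → Set
  Admissible t = ∀ x → C x ≡ true → A x (t x) ≡ true

  redirect : Choice → Fin m → Fin n → Choice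
  redirect t x₀ z x = if x == x₀ then z else t x

  redirect-same : ∀ t x₀ z → redirect t x₀ z x₀ ≡ z
  redirect-same t x₀ z rewrite ==-refl x₀ = refl

  redirect-other : ∀ t x₀ z {x} → x ≢ x₀ → redirect t x₀ z x ≡ t x
  redirect-other t x₀ z x≢x₀ rewrite ==-false x≢x₀ = refl

  load-redirect : ∀ t x₀ z → C x₀ ≡ true → ∀ v →
                  load C (redirect t x₀ z) v + ι (v == t x₀) ≡ load C t v + ι (v == z)
  load-redirect t x₀ z Cx₀ v = begin
    load C t′ v + ι (v == t x₀)              ≡⟨ cong (λ c → load C t′ v + ι (c ∧ (v == t x₀))) Cx₀ ⟨
    load C t′ v + ι (C x₀ ∧ (v == t x₀))     ≡⟨ sum-update x₀ _ _ unchanged ⟩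
    load C t v + ι (C x₀ ∧ (v == t′ x₀))     ≡⟨ cong (λ c → load C t v + ι (c ∧ (v == t′ x₀))) Cx₀ ⟩
    load C t v + ι (v == t′ x₀)              ≡⟨ cong (λ y → load C t v + ι (v == y)) (redirect-same t x₀ z) ⟩
    load C t v + ι (v == z)                  ∎
    where
    open ≡-Reasoning
    t′ = redirect t x₀ z
    unchanged : ∀ x → x ≢ x₀ → ι (C x ∧ (v == t′ x)) ≡ ι (C x ∧ (v == t x))
    unchanged x x≢x₀ = cong (λ y → ι (C x ∧ (v == y))) (redirect-other t x₀ z x≢x₀)

  Path : Choice → ℕ → Fin n → Fin n → Set
  Path t zero    u w = u ≡ w
  Path t (suc l) u w = u ≡ w ⊎ ∃₂ λ x z → C x ≡ true × t x ≡ u × A x z ≡ true × Path t l z w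

  path? : ∀ t l u w → Dec (Path t l u w)
  path? t zero    u w = u ≟ w
  path? t (suc l) u w = (u ≟ w) ⊎-dec any? λ x → any? λ z →
    (C x Bool.≟ true) ×-dec (t x ≟ u) ×-dec (A x z Bool.≟ true) ×-dec path? t l z w

  path-weaken : ∀ {t k l u w} → k ≤ l → Path t k u w → Path t l u w
  path-weaken {k = zero}  {zero}  _ p = p
  path-weaken {k = zero}  {suc l} _ p = inj₁ p
  path-weaken {k = suc k} {suc l} _ (inj₁ p) = inj₁ p
  path-weaken {k = suc k} {suc l} (s≤s k≤l) (inj₂ (x , z , Cx , tx , Axz , p)) =
    inj₂ (x , z , Cx , tx , Axz , path-weaken k≤l p)

  path-refl : ∀ t l u → Path t l u u
  path-refl t l u = path-weaken {t} {0} z≤n refl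

  path-snoc : ∀ {t l u v} x z → Path t l u v → C x ≡ true → t x ≡ v → A x z ≡ true → Path t (suc l) u z
  path-snoc {l = zero}  x z refl Cx tx Axz = inj₂ (x , z , Cx , tx , Axz , refl)
  path-snoc {l = suc l} x z (inj₁ refl) Cx tx Axz = inj₂ (x , z , Cx , tx , Axz , inj₁ refl)
  path-snoc {l = suc l} x z (inj₂ (x′ , z′ , Cx′ , tx′ , Ax′z′ , p)) Cx tx Axz =
    inj₂ (x′ , z′ , Cx′ , tx′ , Ax′z′ , path-snoc x z p Cx tx Axz)

  Shortest : Choice → ℕ → Fin n → Fin n → Set
  Shortest t l u w = ∀ k → k < l → ¬ Path t k u w

  shorten : ∀ t l u w → Path t l u w → ∃ λ k → Path t k u w × Shortest t k u w
  shorten t zero    u w p = 0 , p , λ _ ()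
  shorten t (suc l) u w p with path? t l u w
  ... | yes q = shorten t l u w q
  ... | no ¬q = suc l , p , λ k k<1+l q → ¬q (path-weaken (≤-pred k<1+l) q)

  record Augmentation (t : Choice) (l : ℕ) (u w : Fin n) : Set where
    field
      choice     : Choice
      admissible : Admissible choice
      transfer   : ∀ v → load C choice v + ι (v == u) ≡ load C t v + ι (v == w)
      local      : ∀ x → choice x ≡ t x ⊎ Path t l (t x) w

  -- Shift every client on a shortest path u ⇝ w one step forward.  The first client x on the
  -- path is not touched by the shift of the rest of the path, since the path is shortest.
  augment : ∀ t l u w → Admissible t → Path t l u w → Shortest t l u w → Augmentation t l u w
  augment t zero u w adm refl _ = record
    { choice = t ; admissible = adm ; transfer = λ _ → refl ; local = λ _ → inj₁ refl }
  augment t (suc l) u w adm (inj₁ refl) _ = record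
    { choice = t ; admissible = adm ; transfer = λ _ → refl ; local = λ _ → inj₁ refl }
  augment t (suc l) u w adm (inj₂ (x , z , Cx , tx≡u , Axz , p)) shortest = record
    { choice = t′ ; admissible = admissible′ ; transfer = transfer′ ; local = local′ }
    where
    rest : Augmentation t l z w
    rest = augment t l z w adm p λ k k<l q → shortest (suc k) (s≤s k<l) (inj₂ (x , z , Cx , tx≡u , Axz , q))
    module R = Augmentation rest

    x-untouched : R.choice x ≡ u
    x-untouched with R.local x
    ... | inj₁ e = trans e tx≡u
    ... | inj₂ q = ⊥-elim (shortest l (n<1+n l) (subst (λ y → Path t l y w) tx≡u q))

    t′ = redirect R.choice x z

    admissible′ : Admissible t′
    admissible′ x′ Cx′ with x′ ≟ x
    ... | yes refl = Axz
    ... | no _     = R.admissible x′ Cx′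

    transfer′ : ∀ v → load C t′ v + ι (v == u) ≡ load C t v + ι (v == w)
    transfer′ v = begin
      load C t′ v + ι (v == u)              ≡⟨ cong (λ y → load C t′ v + ι (v == y)) x-untouched ⟨
      load C t′ v + ι (v == R.choice x)     ≡⟨ load-redirect R.choice x z Cx v ⟩
      load C R.choice v + ι (v == z)        ≡⟨ R.transfer v ⟩
      load C t v + ι (v == w)               ∎
      where open ≡-Reasoning

    local′ : ∀ x′ → t′ x′ ≡ t x′ ⊎ Path t (suc l) (t x′) w
    local′ x′ with x′ ≟ x
    ... | yes refl = inj₂ (subst (λ y → Path t (suc l) y w) (sym tx≡u) (inj₂ (x , z , Cx , tx≡u , Axz , p)))
    ... | no _ with R.local x′
    ...   | inj₁ e = inj₁ e
    ...   | inj₂ q = inj₂ (path-weaken (n≤1+n l) q)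

  reachable : Choice → Fin n → ℕ → Fin n → Bool
  reachable t u l v = does (path? t l u v)

  reachable-grows : ∀ t u l v → Path t (suc l) u v → ¬ Path t l u v →
                    count (reachable t u l) < count (reachable t u (suc l))
  reachable-grows t u l v p ¬q = begin-strict
    count (reach l)                              <⟨ m<m+n _ (s≤s z≤n) ⟩
    count (reach l) + 1                          ≡⟨ cong (count (reach l) +_) (count-single v) ⟨
    count (reach l) + count (_== v)              ≡⟨ ∑-distrib-+ (ι ∘ reach l) (λ v′ → ι (v′ == v)) ⟨
    ∑[ v′ < n ] (ι (reach l v′) + ι (v′ == v))   ≤⟨ sum-mono (λ v′ → new v′ (v′ ≟ v)) ⟩
    count (reach (suc l))                        ∎
    where
    open ≤-Reasoning
    reach = reachable t u
    new : ∀ v′ (d : Dec (v′ ≡ v)) → ι (reach l v′) + ι (does d) ≤ ι (reach (suc l) v′)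
    new v′ (yes refl) =
      subst₂ (λ a c → ι a + 1 ≤ ι c) (sym (dec-false (path? t l u v′) ¬q))
             (sym (dec-true (path? t (suc l) u v′) p)) ≤-refl
    new v′ (no _) = subst (_≤ ι (reach (suc l) v′)) (sym (+-identityʳ _)) (ι-mono _ _
      (dec-true (path? t (suc l) u v′) ∘ path-weaken (n≤1+n l) ∘ does-true (path? t l u v′)))

  Closed : Choice → (Fin n → Bool) → Set
  Closed t R = ∀ x z → C x ≡ true → R (t x) ≡ true → A x z ≡ true → R z ≡ true

  load-of-set : ∀ t (R : Fin n → Bool) →
                ∑[ v < n ] (ι (R v) * load C t v) ≡ count (λ x → C x ∧ R (t x))
  load-of-set t R = begin
    ∑[ v < n ] (ι (R v) * load C t v)                       ≡⟨ sum-cong-≗ (λ v → *-distribˡ-sum (ι (R v)) (λ x → ι (C x ∧ (v == t x)))) ⟩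
    ∑[ v < n ] ∑[ x < m ] (ι (R v) * ι (C x ∧ (v == t x)))  ≡⟨ ∑-comm (λ v x → ι (R v) * ι (C x ∧ (v == t x))) ⟩
    ∑[ x < m ] ∑[ v < n ] (ι (R v) * ι (C x ∧ (v == t x)))  ≡⟨ sum-cong-≗ (λ x → pick (C x) (t x)) ⟩
    ∑[ x < m ] ι (C x ∧ R (t x))                            ∎
    where
    open ≡-Reasoning
    pick : ∀ c y → ∑[ v < n ] (ι (R v) * ι (c ∧ (v == y))) ≡ ι (c ∧ R y)
    pick true  y = trans (sum-cong-≗ λ v → *-comm (ι (R v)) _) (sum-pick y (ι ∘ R))
    pick false y = trans (sum-cong-≗ λ v → *-zeroʳ (ι (R v))) (sum-replicate-zero n)

  options-inside : ∀ t (R : Fin n → Bool) → Closed t R →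
                   ∑[ x < m ] (ι (C x ∧ R (t x)) * count (A x)) ≤
                   ∑[ y < n ] (count (λ x → C x ∧ A x y) * ι (R y))
  options-inside t R closed = begin
    ∑[ x < m ] (ι (C x ∧ R (t x)) * count (A x))          ≡⟨ sum-cong-≗ (λ x → *-distribˡ-sum (ι (C x ∧ R (t x))) (ι ∘ A x)) ⟩
    ∑[ x < m ] ∑[ y < n ] (ι (C x ∧ R (t x)) * ι (A x y))  ≤⟨ sum-mono (λ x → sum-mono (λ y → stays x y)) ⟩
    ∑[ x < m ] ∑[ y < n ] (ι (C x ∧ A x y) * ι (R y))      ≡⟨ ∑-comm (λ x y → ι (C x ∧ A x y) * ι (R y)) ⟩
    ∑[ y < n ] ∑[ x < m ] (ι (C x ∧ A x y) * ι (R y))      ≡⟨ sum-cong-≗ (λ y → *-distribʳ-sum (ι (R y)) (λ x → ι (C x ∧ A x y))) ⟨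
    ∑[ y < n ] (count (λ x → C x ∧ A x y) * ι (R y))       ∎
    where
    open ≤-Reasoning
    stays : ∀ x y → ι (C x ∧ R (t x)) * ι (A x y) ≤ ι (C x ∧ A x y) * ι (R y)
    stays x y = ι-*-mono _ _ _ _ λ inside Axy →
      let (Cx , Rtx) = ∧-true inside in cong₂ _∧_ Cx Axy , closed x y Cx Rtx Axy

  module Balancing (L b : ℕ)
      (few-clients  : ∀ y → count (λ x → C x ∧ A x y) ≤ b)
      (many-servers : ∀ x → C x ≡ true → b ≤ L * count (A x)) where

    -- The Hall-type counting argument: no closed set R of servers has all loads ≥ L and one
    -- load > L.  With N clients served inside R,
    --   (L |R| + 1) b ≤ N b ≤ L Σ_{x inside R} |A x| ≤ L b |R|,
    -- forcing b = 0, whereas a client of the overloaded server makes b ≥ 1.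
    no-trap : ∀ t u (R : Fin n → Bool) → Admissible t → Closed t R → R u ≡ true →
              L < load C t u → (∀ v → R v ≡ true → L ≤ load C t v) → ⊥
    no-trap t u R adm closed Ru over full = contradiction (+-cancelˡ-≤ _ b 0 squeeze) (<⇒≱ 0<b)
      where
      open ≤-Reasoning
      N = count (λ x → C x ∧ R (t x))

      above : ∀ v → ι (R v) * L + ι (v == u) ≤ ι (R v) * load C t v
      above v with v ≟ u
      ... | yes refl rewrite Ru | +-identityʳ L | +-identityʳ (load C t v) = subst (_≤ load C t v) (+-comm 1 L) over
      ... | no _ rewrite +-identityʳ (ι (R v) * L) = ι-guard (R v) (full v)

      lower : count R * L + 1 ≤ N
      lower = begin
        count R * L + 1                             ≡⟨ cong₂ _+_ (*-distribʳ-sum L (ι ∘ R)) (sym (count-single u)) ⟩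
        ∑[ v < n ] (ι (R v) * L) + count (_== u)    ≡⟨ ∑-distrib-+ (λ v → ι (R v) * L) (λ v → ι (v == u)) ⟨
        ∑[ v < n ] (ι (R v) * L + ι (v == u))       ≤⟨ sum-mono above ⟩
        ∑[ v < n ] (ι (R v) * load C t v)           ≡⟨ load-of-set t R ⟩
        N                                           ∎

      swap-left : ∀ x y z → x * (y * z) ≡ y * (x * z)
      swap-left = solve-∀

      upper : N * b ≤ L * (b * count R)
      upper = begin
        N * b                                                     ≡⟨ *-distribʳ-sum b (λ x → ι (C x ∧ R (t x))) ⟩
        ∑[ x < m ] (ι (C x ∧ R (t x)) * b)                        ≤⟨ sum-mono (λ x → ι-guard (C x ∧ R (t x)) (many-servers x ∘ proj₁ ∘ ∧-true)) ⟩
        ∑[ x < m ] (ι (C x ∧ R (t x)) * (L * count (A x)))        ≡⟨ sum-cong-≗ (λ x → swap-left (ι (C x ∧ R (t x))) L _) ⟩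
        ∑[ x < m ] (L * (ι (C x ∧ R (t x)) * count (A x)))        ≡⟨ *-distribˡ-sum L (λ x → ι (C x ∧ R (t x)) * count (A x)) ⟨
        L * ∑[ x < m ] (ι (C x ∧ R (t x)) * count (A x))          ≤⟨ *-monoʳ-≤ L (options-inside t R closed) ⟩
        L * ∑[ y < n ] (count (λ x → C x ∧ A x y) * ι (R y))      ≤⟨ *-monoʳ-≤ L (sum-mono (λ y → *-monoˡ-≤ (ι (R y)) (few-clients y))) ⟩
        L * ∑[ y < n ] (b * ι (R y))                              ≡⟨ cong (L *_) (*-distribˡ-sum b (ι ∘ R)) ⟨
        L * (b * count R)                                         ∎

      expand : ∀ r L b → (r * L + 1) * b ≡ L * (b * r) + b
      expand = solve-∀

      squeeze : L * (b * count R) + b ≤ L * (b * count R) + 0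
      squeeze = begin
        L * (b * count R) + b    ≡⟨ expand (count R) L b ⟨
        (count R * L + 1) * b    ≤⟨ *-monoˡ-≤ b lower ⟩
        N * b                    ≤⟨ upper ⟩
        L * (b * count R)        ≡⟨ +-identityʳ _ ⟨
        L * (b * count R) + 0    ∎

      0<b : 0 < b
      0<b with count-witness _ (≤-<-trans z≤n over)
      ... | x , served with ∧-true served
      ...   | Cx , u=tx = begin-strict
        0                                  <⟨ subst (λ c → 0 < ι c) (sym (cong₂ _∧_ Cx Axu)) (s≤s z≤n) ⟩
        ι (C x ∧ A x u)                    ≤⟨ term≤sum (λ x′ → ι (C x′ ∧ A x′ u)) x ⟩
        count (λ x′ → C x′ ∧ A x′ u)       ≤⟨ few-clients u ⟩
        b                                  ∎
        where
        Axu : A x u ≡ true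
        Axu = subst (λ y → A x y ≡ true) (sym (==-sound u=tx)) (adm x Cx)

    -- total load above the bound L; it is the termination measure of the balancing
    excess : Choice → ℕ
    excess t = ∑[ v < n ] (load C t v ∸ L)

    excess-decreases : ∀ {t t′ u w} →
                       (∀ v → load C t′ v + ι (v == u) ≡ load C t v + ι (v == w)) →
                       L < load C t u → load C t w < L → excess t′ < excess t
    excess-decreases {t} {t′} {u} {w} transfer over under = begin-strict
      excess t′                                          <⟨ n<1+n _ ⟩
      1 + excess t′                                       ≡⟨ +-comm 1 (excess t′) ⟩
      excess t′ + 1                                       ≡⟨ cong (excess t′ +_) (count-single u) ⟨
      excess t′ + count (_== u)                           ≡⟨ ∑-distrib-+ (λ v → load C t′ v ∸ L) (λ v → ι (v == u)) ⟨
      ∑[ v < n ] ((load C t′ v ∸ L) + ι (v == u))         ≤⟨ sum-mono (λ v → pointwise (v ≟ u) (v ≟ w) (transfer v)) ⟩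
      excess t                                            ∎
      where
      open ≤-Reasoning
      pointwise : ∀ {v} (v=u : Dec (v ≡ u)) (v=w : Dec (v ≡ w)) →
                  load C t′ v + ι (does v=u) ≡ load C t v + ι (does v=w) →
                  (load C t′ v ∸ L) + ι (does v=u) ≤ load C t v ∸ L
      pointwise (yes refl) (yes refl) _ = contradiction over (<-asym under)
      pointwise {v} (yes refl) (no _) e =
        ≤-reflexive (trans (sym (+-∸-comm 1 L≤)) (cong (_∸ L) e′))
        where
        e′ : load C t′ v + 1 ≡ load C t v
        e′ = trans e (+-identityʳ _)
        L≤ : L ≤ load C t′ v
        L≤ = ≤-pred (subst (L <_) (trans (sym e′) (+-comm _ 1)) over)
      pointwise {v} (no _) (yes refl) e =
        subst (_≤ load C t v ∸ L) (sym (trans (+-identityʳ _) (m≤n⇒m∸n≡0 ≤L))) z≤n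
        where
        ≤L : load C t′ v ≤ L
        ≤L = subst (_≤ L) (sym (trans (sym (+-identityʳ _)) (trans e (+-comm _ 1)))) under
      pointwise (no _) (no _) e =
        ≤-reflexive (trans (+-identityʳ _) (cong (_∸ L) (trans (sym (+-identityʳ _)) (trans e (+-identityʳ _)))))

    -- Breadth-first search from an overloaded server u.  Let R l be the set of servers reachable
    -- from u within l moves.  If R l contains an underloaded server, augmenting along a shortest
    -- path to it lowers the excess; if R (l + 1) = R l, then R l is a trap, which is impossible;
    -- otherwise R grows, which can happen at most n times.
    improve : ∀ t u → Admissible t → L < load C t u → ∃ λ t′ → Admissible t′ × excess t′ < excess t
    improve t u adm over = search n 0 (m≤n+m n (count (reach 0)))
      where
      reach : ℕ → Fin n → Bool
      reach = reachable t u

      search : ∀ fuel l → n ≤ count (reach l) + fuel → ∃ λ t′ → Admissible t′ × excess t′ < excess t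
      search fuel l room with any? (λ w → path? t l u w ×-dec load C t w <? L)
      ... | yes (w , p , under) with shorten t l u w p
      ...   | k , q , shortest = Aug.choice , Aug.admissible , excess-decreases Aug.transfer over under
        where module Aug = Augmentation (augment t k u w adm q shortest)
      search fuel l room | no no-light with any? (λ v → path? t (suc l) u v ×-dec ¬? (path? t l u v))
      ... | no no-new =
        ⊥-elim (no-trap t u (reach l) adm closed (dec-true (path? t l u u) (path-refl t l u)) over full)
        where
        full : ∀ v → reach l v ≡ true → L ≤ load C t v
        full v r = ≮⇒≥ λ under → no-light (v , does-true (path? t l u v) r , under)
        closed : Closed t (reach l)
        closed x z Cx r Axz with path? t l u z
        ... | yes _ = refl
        ... | no ¬p = ⊥-elim (no-new (z , path-snoc x z (does-true (path? t l u (t x)) r) Cx refl Axz , ¬p))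
      search zero l room | no _ | yes (v , p , ¬q) =
        contradiction (count≤ (reach (suc l)))
          (<⇒≱ (≤-<-trans (subst (n ≤_) (+-identityʳ _) room) (reachable-grows t u l v p ¬q)))
      search (suc fuel) l room | no _ | yes (v , p , ¬q) =
        search fuel (suc l) (≤-trans room (≤-trans (≤-reflexive (+-suc _ fuel)) (+-monoˡ-≤ fuel (reachable-grows t u l v p ¬q))))

    -- repeatedly relieve an overloaded server; the excess bounds the number of rounds
    balance : ∀ fuel t → Admissible t → excess t ≤ fuel → ∃ λ t′ → Admissible t′ × ∀ v → load C t′ v ≤ L
    balance fuel t adm bound with any? (λ u → L <? load C t u)
    ... | no none-over = t , adm , λ v → ≮⇒≥ λ over → none-over (v , over)
    balance zero t adm bound | yes (u , over) =
      contradiction (≤-trans (term≤sum (λ v → load C t v ∸ L) u) bound) (<⇒≱ (m<n⇒0<n∸m over))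
    balance (suc fuel) t adm bound | yes (u , over) with improve t u adm over
    ... | t′ , adm′ , smaller = balance fuel t′ adm′ (≤-pred (≤-trans smaller bound))

    balanced-choice : ∀ t → Admissible t → ∃ λ t′ → Admissible t′ × ∀ v → load C t′ v ≤ L
    balanced-choice t adm = balance (excess t) t adm ≤-refl

unused-colour : ∀ {k c} (S : Fin c → Bool) (P : Fin k → Bool) (f : Fin k → Fin c) →
                count P < count S → ∃ λ γ → S γ ≡ true × ∀ x → P x ≡ true → f x ≢ γ
unused-colour {zero} S P f fewer with count-witness S fewer
... | γ , Sγ = γ , Sγ , λ ()
unused-colour {suc k} {c} S P f fewer with P zero in P₀
... | false = γ , Sγ , avoids′
  where
  rest = unused-colour S (P ∘ suc) (f ∘ suc) fewer
  γ = proj₁ rest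
  Sγ = proj₁ (proj₂ rest)
  avoids′ : ∀ x → P x ≡ true → f x ≢ γ
  avoids′ zero    P₀′ = contradiction (trans (sym P₀) P₀′) λ ()
  avoids′ (suc x) = proj₂ (proj₂ rest) x
... | true = γ , proj₁ (∧-true {S γ} S′γ) , avoids′
  where
  S′ : Fin c → Bool
  S′ γ = S γ ∧ not (γ == f zero)
  split : ∀ a b → ι a ≤ ι (a ∧ not b) + ι b
  split true  true  = s≤s z≤n
  split true  false = ≤-refl
  split false _     = z≤n
  available : count S ≤ count S′ + 1
  available = begin
    count S                                           ≤⟨ sum-mono (λ γ → split (S γ) (γ == f zero)) ⟩
    ∑[ γ < c ] (ι (S′ γ) + ι (γ == f zero))           ≡⟨ ∑-distrib-+ (ι ∘ S′) (λ γ → ι (γ == f zero)) ⟩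
    count S′ + count (_== f zero)                     ≡⟨ cong (count S′ +_) (count-single (f zero)) ⟩
    count S′ + 1                                      ∎
    where open ≤-Reasoning
  fewer′ : count (P ∘ suc) < count S′
  fewer′ = +-cancelʳ-≤ 1 _ _ (≤-trans (≤-reflexive (+-comm (suc (count (P ∘ suc))) 1)) (≤-trans fewer available))
  rest = unused-colour S′ (P ∘ suc) (f ∘ suc) fewer′
  γ = proj₁ rest
  S′γ = proj₁ (proj₂ rest)
  avoids′ : ∀ x → P x ≡ true → f x ≢ γ
  avoids′ zero    _ f₀≡γ = contradiction
    (trans (sym (cong not (==-refl γ))) (subst (λ y → not (γ == y) ≡ true) f₀≡γ (proj₂ (∧-true {S γ} S′γ)))) λ ()
  avoids′ (suc x) = proj₂ (proj₂ rest) x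

module Greedy {k n : ℕ} (C : Fin k → Bool) (t m : Fin k → Fin n) (L : ℕ)
    (earlier : ∀ x → C x ≡ true → toℕ (m x) < toℕ (t x))
    (light   : ∀ v → load C t v ≤ L) where

  Colouring : Set
  Colouring = Fin n → Fin (suc L)

  Respects : ℕ → Colouring → Set
  Respects i col = ∀ x → C x ≡ true → toℕ (t x) < i → col (t x) ≢ col (m x)

  recolour : Colouring → Fin n → Fin (suc L) → Colouring
  recolour col v γ y = if y == v then γ else col y

  extend : ∀ {i} (i<n : i < n) → ∃ (Respects i) → ∃ (Respects (suc i))
  extend {i} i<n (col , respects) = recolour col v γ , respects′
    where
    v : Fin n
    v = fromℕ< i<n
    free = unused-colour (λ _ → true) (λ x → C x ∧ (v == t x)) (λ x → col (m x))
             (subst (load C t v <_) (sym (count-all (suc L))) (s≤s (light v)))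
    γ = proj₁ free

    unchanged : ∀ y → toℕ y < i → recolour col v γ y ≡ col y
    unchanged y y<i rewrite ==-false {i = y} {v} (λ y≡v → <-irrefl (trans (cong toℕ y≡v) (toℕ-fromℕ< i<n)) y<i) = refl

    respects′ : Respects (suc i) (recolour col v γ)
    respects′ x Cx tx<1+i with m<1+n⇒m<n∨m≡n tx<1+i
    ... | inj₁ tx<i rewrite unchanged (t x) tx<i | unchanged (m x) (<-trans (earlier x Cx) tx<i) = respects x Cx tx<i
    ... | inj₂ tx≡i = λ e → proj₂ (proj₂ free) x served
                            (trans (sym (unchanged (m x) mx<i)) (trans (sym e) coloured))
      where
      tx=v : t x ≡ v
      tx=v = toℕ-injective (trans tx≡i (sym (toℕ-fromℕ< i<n)))
      mx<i : toℕ (m x) < i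
      mx<i = subst (toℕ (m x) <_) tx≡i (earlier x Cx)
      coloured : recolour col v γ (t x) ≡ γ
      coloured rewrite tx=v | ==-refl v = refl
      served : (C x ∧ (v == t x)) ≡ true
      served rewrite Cx | tx=v = ==-refl v

  colour-below : ∀ i → i ≤ n → ∃ (Respects i)
  colour-below zero    _   = (λ _ → zero) , λ _ _ ()
  colour-below (suc i) i<n = extend i<n (colour-below i (<⇒≤ i<n))

  greedy-colouring : ∃ λ col → ∀ x → C x ≡ true → col (t x) ≢ col (m x)
  greedy-colouring with colour-below n ≤-refl
  ... | col , respects = col , λ x Cx → respects x Cx (toℕ<n (t x))

first : ∀ {k} → (Fin k → Bool) → Maybe (Fin k)
first {zero}  P = nothing
first {suc k} P = if P zero then just zero else Maybe.map suc (first (P ∘ suc))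

first-least : ∀ {k} (P : Fin k → Bool) y → P y ≡ true →
              ∃ λ i → first P ≡ just i × P i ≡ true × ∀ z → P z ≡ true → toℕ i ≤ toℕ z
first-least {suc k} P y Py with P zero in P₀
... | true = zero , refl , P₀ , λ _ _ → z≤n
first-least {suc k} P zero    Py | false = contradiction (trans (sym P₀) Py) λ ()
first-least {suc k} P (suc y) Py | false with first-least (P ∘ suc) y Py
... | i , first≡i , Pi , least = suc i , cong (Maybe.map suc) first≡i , Pi , least′
  where
  least′ : ∀ z → P z ≡ true → suc (toℕ i) ≤ toℕ z
  least′ zero    Pz = contradiction (trans (sym P₀) Pz) λ ()
  least′ (suc z) Pz = s≤s (least z Pz)

length-filter-tabulate : ∀ {A : Set} k (p : A → Bool) (f : Fin k → A) →
                         length (filterᵇ p (tabulate f)) ≡ count (p ∘ f)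
length-filter-tabulate zero    p f = refl
length-filter-tabulate (suc k) p f with p (f zero)
... | true  = cong suc (length-filter-tabulate k p (f ∘ suc))
... | false = length-filter-tabulate k p (f ∘ suc)

degree-count : ∀ {n} (G : SimpleGraph n) v → degree G v ≡ count (adj G v)
degree-count {n} G v = length-filter-tabulate n (adj G v) (λ i → i)

module Dynamic {n : ℕ} (G : SimpleGraph n) (L Δ : ℕ)
    (max-degree : ∀ v → degree G v ≤ Δ)
    (enough     : ∀ v → 2 ≤ degree G v → Δ ≤ L * (degree G v ∸ 1)) where

  C : Fin n → Bool
  C x = does (2 ≤? degree G x)

  anchor : Fin n → Fin n
  anchor x = fromMaybe x (first (adj G x))

  A : Fin n → Fin n → Bool
  A x y = adj G x y ∧ does (toℕ (anchor x) <? toℕ y)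

  -- a constrained vertex has neighbours, so its anchor is its least neighbour
  anchor-least : ∀ x → C x ≡ true →
                 adj G x (anchor x) ≡ true × ∀ z → adj G x z ≡ true → toℕ (anchor x) ≤ toℕ z
  anchor-least x Cx with count-witness (adj G x)
                           (subst (0 <_) (degree-count G x) (≤-trans (s≤s z≤n) (does-true (2 ≤? degree G x) Cx)))
  ... | y , xy with first-least (adj G x) y xy
  ...   | i , first≡i , xi , least rewrite first≡i = xi , least

  options : ∀ x → C x ≡ true → count (A x) + 1 ≡ degree G x
  options x Cx = begin
    count (A x) + 1                              ≡⟨ cong (count (A x) +_) (count-single (anchor x)) ⟨
    count (A x) + count (_== anchor x)           ≡⟨ ∑-distrib-+ (ι ∘ A x) (λ y → ι (y == anchor x)) ⟨
    ∑[ y < n ] (ι (A x y) + ι (y == anchor x))   ≡⟨ sum-cong-≗ (λ y → split y (y ≟ anchor x)) ⟩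
    count (adj G x)                              ≡⟨ degree-count G x ⟨
    degree G x                                   ∎
    where
    open ≡-Reasoning
    split : ∀ y (d : Dec (y ≡ anchor x)) → ι (A x y) + ι (does d) ≡ ι (adj G x y)
    split _ (yes refl) rewrite proj₁ (anchor-least x Cx)
                             | dec-false (toℕ (anchor x) <? toℕ (anchor x)) (<-irrefl refl) = refl
    split y (no y≢a) with adj G x y in xy
    ... | false = refl
    ... | true rewrite dec-true (toℕ (anchor x) <? toℕ y)
                         (≤∧≢⇒< (proj₂ (anchor-least x Cx) y xy) (λ e → y≢a (sym (toℕ-injective e)))) = refl

  few-clients : ∀ y → count (λ x → C x ∧ A x y) ≤ Δ
  few-clients y = ≤-trans (sum-mono λ x → ι-mono _ _ (adjacent x))
                          (subst (_≤ Δ) (degree-count G y) (max-degree y))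
    where
    adjacent : ∀ x → (C x ∧ A x y) ≡ true → adj G y x ≡ true
    adjacent x e = trans (SimpleGraph.sym G y x) (proj₁ (∧-true {adj G x y} (proj₂ (∧-true {C x} e))))

  many-servers : ∀ x → C x ≡ true → Δ ≤ L * count (A x)
  many-servers x Cx = subst (λ c → Δ ≤ L * c) (trans (cong (_∸ 1) (sym (options x Cx))) (m+n∸n≡m _ 1))
                            (enough x (does-true (2 ≤? degree G x) Cx))

  initial : ∀ x → ∃ λ y → C x ≡ true → A x y ≡ true
  initial x with any? (λ y → A x y Bool.≟ true)
  ... | yes (y , Axy) = y , λ _ → Axy
  ... | no none = x , λ Cx → contradiction (count-witness (A x) (positive Cx)) none
    where
    positive : C x ≡ true → 0 < count (A x)
    positive Cx = +-cancelʳ-≤ 1 1 _ (subst (2 ≤_) (sym (options x Cx)) (does-true (2 ≤? degree G x) Cx))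

  open LoadBalancing C A using (module Balancing)
  open Balancing L Δ few-clients many-servers using (balanced-choice)

  dynamic-colouring : HasDynamicColouring G (suc L)
  dynamic-colouring with balanced-choice (proj₁ ∘ initial) (proj₂ ∘ initial)
  ... | t , admissible , light = proj₁ coloured , dynamic
    where
    after-anchor : ∀ x → C x ≡ true → toℕ (anchor x) < toℕ (t x)
    after-anchor x Cx = does-true (toℕ (anchor x) <? toℕ (t x)) (proj₂ (∧-true {adj G x (t x)} (admissible x Cx)))
    coloured = Greedy.greedy-colouring C t anchor L after-anchor light
    dynamic : IsDynamic G (proj₁ coloured)
    dynamic v 2≤deg = t v , anchor v , proj₁ (∧-true (admissible v Cv)) , proj₁ (anchor-least v Cv) , proj₂ coloured v Cv
      where
      Cv : C v ≡ true
      Cv = dec-true (2 ≤? degree G v) 2≤deg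

ceilDiv-bound : ∀ a d .{{_ : NonZero d}} → a ≤ ceilDiv a d * d
ceilDiv-bound a d@(suc d′) = +-cancelʳ-≤ d′ a _ (begin
  a + d′                          ≡⟨ m≡m%n+[m/n]*n (a + d′) d ⟩
  (a + d′) % d + ceilDiv a d * d  ≤⟨ +-monoˡ-≤ _ (≤-pred (m%n<n (a + d′) d)) ⟩
  d′ + ceilDiv a d * d            ≡⟨ +-comm d′ _ ⟩
  ceilDiv a d * d + d′            ∎)
  where open ≤-Reasoning

half-≤ : ∀ {a b} → 2 * a ≤ 2 * b + 1 → a ≤ b
half-≤ {a} {b} h = ≮⇒≥ λ b<a → contradiction (+-cancelˡ-≤ (2 * b) 2 1 (begin
  2 * b + 2      ≡⟨ double-suc b ⟩
  2 * suc b      ≤⟨ *-monoʳ-≤ 2 b<a ⟩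
  2 * a          ≤⟨ h ⟩
  2 * b + 1      ∎)) λ { (s≤s ()) }
  where
  open ≤-Reasoning
  double-suc : ∀ b → 2 * b + 2 ≡ 2 * suc b
  double-suc = solve-∀

-- If 2Δ ≤ kδ, δ ≤ d and 2 ≤ d, then Δ ≤ k (d − 1), since d ≤ 2 (d − 1).
condition₁ : ∀ k δ Δ d → 2 * Δ ≤ k * δ → δ ≤ d → 2 ≤ d → Δ ≤ k * (d ∸ 1)
condition₁ k δ Δ (suc (suc e)) 2Δ≤kδ δ≤d (s≤s (s≤s z≤n)) = *-cancelˡ-≤ 2 (begin
  2 * Δ                  ≤⟨ 2Δ≤kδ ⟩
  k * δ                  ≤⟨ *-monoʳ-≤ k δ≤d ⟩
  k * (2 + e)            ≤⟨ *-monoʳ-≤ k (+-monoʳ-≤ 2 (m≤n+m e e)) ⟩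
  k * (2 + (e + e))      ≡⟨ rearrange k e ⟩
  2 * (k * suc e)        ∎)
  where
  open ≤-Reasoning
  rearrange : ∀ k e → k * (2 + (e + e)) ≡ 2 * (k * suc e)
  rearrange = solve-∀

-- If 2Δ ≤ kδ with k, δ ≥ 3 and δ ≤ d, then Δ ≤ (k − 1)(d − 1): indeed
-- kδ ≤ 2 (k − 1)(δ − 1) + 1, as (k − 2)(δ − 2) ≥ 1.
condition₂ : ∀ k δ Δ d → 3 ≤ k → 3 ≤ δ → δ ≤ d → 2 * Δ ≤ k * δ → Δ ≤ (k ∸ 1) * (d ∸ 1)
condition₂ k@(suc (suc (suc i))) δ@(suc (suc (suc j))) Δ d (s≤s (s≤s (s≤s z≤n))) (s≤s (s≤s (s≤s z≤n))) δ≤d 2Δ≤kδ = begin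
  Δ                       ≤⟨ half-≤ (begin
      2 * Δ                               ≤⟨ 2Δ≤kδ ⟩
      k * δ                               ≤⟨ m≤m+n (k * δ) (i + j + i * j) ⟩
      k * δ + (i + j + i * j)             ≡⟨ expand i j ⟩
      2 * ((k ∸ 1) * (δ ∸ 1)) + 1         ∎) ⟩
  (k ∸ 1) * (δ ∸ 1)       ≤⟨ *-monoʳ-≤ (k ∸ 1) (∸-monoˡ-≤ 1 δ≤d) ⟩
  (k ∸ 1) * (d ∸ 1)       ∎
  where
  open ≤-Reasoning
  expand : ∀ i j → (3 + i) * (3 + j) + (i + j + i * j) ≡ 2 * ((2 + i) * (2 + j)) + 1
  expand = solve-∀

theorem2 : ∀ {n} (G : SimpleGraph n) (δ Δ : ℕ) → IsMinDegree G δ → IsMaxDegree G Δ → .{{_ : NonZero δ}} → let k = ceilDiv (2 * Δ) δ in HasDynamicColouring G (suc k) × (3 ≤ δ → 3 ≤ k → HasDynamicColouring G k)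
theorem2 G δ Δ (δ-min , _) (Δ-max , _) = k+1-colours , k-colours
  where
  k = ceilDiv (2 * Δ) δ

  2Δ≤kδ : 2 * Δ ≤ k * δ
  2Δ≤kδ = ceilDiv-bound (2 * Δ) δ

  k+1-colours : HasDynamicColouring G (suc k)
  k+1-colours = Dynamic.dynamic-colouring G k Δ Δ-max λ v 2≤dv →
    condition₁ k δ Δ (degree G v) 2Δ≤kδ (δ-min v) 2≤dv

  k-colours : 3 ≤ δ → 3 ≤ k → HasDynamicColouring G k
  k-colours 3≤δ 3≤k = subst (HasDynamicColouring G) (m+[n∸m]≡n (≤-trans (s≤s z≤n) 3≤k))
    (Dynamic.dynamic-colouring G (k ∸ 1) Δ Δ-max λ v _ →
      condition₂ k δ Δ (degree G v) 3≤k 3≤δ (δ-min v) 2Δ≤kδ)
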